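{- For integers $n\ge i\ge 0$, let $\alpha_{n,i}$ be the total number of $\mathbf{u}$-steps at level $i+1$ in all G-Motzkin paths of length $n+1$. Then for every integer $n\ge 0$, \[ \sum_{i=0}^{n}(-1)^{i}\binom{i+2}{2}\alpha_{n,i}=(n+1)^{2}. \]
   Context: A G-Motzkin path of length $N$ is a lattice path from $(0,0)$ to $(N,0)$ that never goes below the $x$-axis and consists of up steps $\mathbf{u}=(1,1)$, down steps $\mathbf{d}=(1,-1)$, horizontal steps $\mathbf{h}=(1,0)$ and vertical steps $\mathbf{v}=(0,-1)$. A step is at level $\ell$ if the ordinate of its endpoint is $\ell$. -}

module Defs where

open import Data.Nat using (ℕ; zero; suc; _+_; _*_; _≡ᵇ_)
open import Data.Bool using (Bool; true; false; _∧_; if_then_else_)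
open import Data.List using (List; []; _∷_; map; concat; filter; upTo; length)
open import Data.Nat.ListAction using (sum)
open import Data.Integer as ℤ using (ℤ; +_)
open import Data.Nat.Combinatorics using (_C_)
open import Relation.Nullary.Decidable using (does)
open import Data.Bool.Properties using (T?)

-- The four step types: u = (1,1), d = (1,-1), h = (1,0), v = (0,-1).
data Step : Set where
  u d h v : Step

width : Step → ℕ
width v = 0
width _ = 1

-- total horizontal extent (the "length" N of the path)
xlen : List Step → ℕ
xlen [] = 0
xlen (s ∷ w) = width s + xlen w

validFrom : ℕ → List Step → Bool
validFrom zero    []      = true
validFrom (suc _) []      = false
validFrom y       (u ∷ w) = validFrom (suc y) w
validFrom y       (h ∷ w) = validFrom y w
validFrom zero    (d ∷ w) = false
validFrom (suc y) (d ∷ w) = validFrom y w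
validFrom zero    (v ∷ w) = false
validFrom (suc y) (v ∷ w) = validFrom y w

isGMotzkin : ℕ → List Step → Bool
isGMotzkin N w = (xlen w ≡ᵇ N) ∧ validFrom 0 w

wordsOfLength : ℕ → List (List Step)
wordsOfLength zero = [] ∷ []
wordsOfLength (suc k) =
  concat (map (λ s → map (s ∷_) (wordsOfLength k)) (u ∷ d ∷ h ∷ v ∷ []))

wordsUpTo : ℕ → List (List Step)
wordsUpTo k = concat (map wordsOfLength (upTo (suc k)))

-- A G-Motzkin path of length N has
-- at most N non-vertical steps and at most as many v-steps as u-steps
-- (hence ≤ N), so it has at most 2N steps; the list below therefore
-- contains every G-Motzkin path of length N exactly once.
gMotzkinPaths : ℕ → List (List Step)
gMotzkinPaths N = filter (λ w → T? (isGMotzkin N w)) (wordsUpTo (2 * N))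

-- number of u-steps at level ℓ (endpoint ordinate ℓ), starting at ordinate y
countUAt : ℕ → ℕ → List Step → ℕ
countUAt ℓ y [] = 0
countUAt ℓ y (u ∷ w) = (if suc y ≡ᵇ ℓ then 1 else 0) + countUAt ℓ (suc y) w
countUAt ℓ y (h ∷ w) = countUAt ℓ y w
countUAt ℓ zero (d ∷ w) = countUAt ℓ zero w
countUAt ℓ (suc y) (d ∷ w) = countUAt ℓ y w
countUAt ℓ zero (v ∷ w) = countUAt ℓ zero w
countUAt ℓ (suc y) (v ∷ w) = countUAt ℓ y w

α : ℕ → ℕ → ℕ
α n i = sum (map (countUAt (suc i) 0) (gMotzkinPaths (suc n)))

signℤ : ℕ → ℤ
signℤ zero = + 1
signℤ (suc i) = ℤ.- signℤ i

altSum : ℕ → ℤ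
altSum n = Data.List.foldr ℤ._+_ (+ 0)
  (map (λ i → signℤ i ℤ.* (+ (((i + 2) C 2) * α n i))) (upTo (suc n)))

-- Let count y and weighted y be the generating functions, by horizontal length, of the paths from
-- level y down to the axis, the latter weighting each path by the sum of (-1)^i C(i+2,2) over its
-- u-steps at levels i+1; the theorem is that weighted 0 = x(1+x)/(1-x)³ = Σ N² x^N. Splitting off
-- the first step, both families satisfy the same linear recurrence in the level y, with the extra
-- term (-1)^y C(y+2,2) x count (y+1) for the weighted one. That recurrence has at most one
-- solution, and (1-x)³ weighted y has an explicit one: a combination of count y and count (y+1)
-- whose coefficients are polynomials in x and ⌊y/2⌋. At level 0 the recurrence for count collapses
-- it to x + x².

module Submission where

open import Defs
open import Data.Nat using (ℕ; suc; _^_)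
open import Data.Integer using (+_)
open import Relation.Binary.PropositionalEquality using (_≡_)

open import Data.Bool using (Bool; true; false; _∧_; T; if_then_else_)
open import Data.Bool.Properties using (∧-zeroʳ; T-∧; T?)
open import Data.Integer using (ℤ; 0ℤ; 1ℤ; -1ℤ; _+_; _*_; _-_; -_)
open import Data.Integer.Properties
  using (+-identityˡ; +-identityʳ; +-assoc; *-zeroʳ; *-identityˡ; *-identityʳ; *-assoc; *-distribˡ-+;
         pos-*; neg-involutive; -1*i≡-i)
open import Data.Integer.Tactic.RingSolver using (solve-∀; solve)
open import Data.List using (List; []; _∷_; _∷ʳ_; [_]; _++_; map; concat; filter; foldr; upTo)
open import Data.List.Properties using (map-upTo; upTo-∷ʳ)
open import Data.Nat as ℕ using (zero; _≤_; _<_; _≤′_; ≤′-refl; ≤′-step; s≤s; s≤s⁻¹; z≤n; parity; ⌊_/2⌋; _≡ᵇ_)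
import Data.Nat.Properties as ℕₚ
open import Data.Nat.Combinatorics using (_C_; nC1≡n; nCk+nC[k+1]≡[n+1]C[k+1])
open import Data.Nat.ListAction using (sum)
import Data.Nat.Tactic.RingSolver as ℕ-Solver
open import Data.Parity.Base using (Parity; 0ℙ; 1ℙ)
open import Data.Product using (Σ; _,_; proj₁)
open import Data.Sum using (_⊎_; inj₁; inj₂)
open import Function using (_∘_)
open import Function.Bundles using (Equivalence)
open import Relation.Binary.PropositionalEquality using (refl; sym; trans; cong; cong₂; module ≡-Reasoning)

open ≡-Reasoning

∑ : {A : Set} → List A → (A → ℤ) → ℤ
∑ xs f = foldr _+_ 0ℤ (map f xs)

syntax ∑ xs (λ x → e) = ∑[ x ∈ xs ] e

module _ {A : Set} where

  ∑-cong : ∀ (xs : List A) {f g : A → ℤ} → (∀ x → f x ≡ g x) → ∑ xs f ≡ ∑ xs g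
  ∑-cong []       f≗g = refl
  ∑-cong (x ∷ xs) f≗g = cong₂ _+_ (f≗g x) (∑-cong xs f≗g)

  ∑-zero : ∀ (xs : List A) → ∑[ x ∈ xs ] 0ℤ ≡ 0ℤ
  ∑-zero []       = refl
  ∑-zero (x ∷ xs) = trans (+-identityˡ _) (∑-zero xs)

  ∑-++ : ∀ (xs ys : List A) f → ∑ (xs ++ ys) f ≡ ∑ xs f + ∑ ys f
  ∑-++ []       ys f = sym (+-identityˡ _)
  ∑-++ (x ∷ xs) ys f = trans (cong (_+_ (f x)) (∑-++ xs ys f)) (sym (+-assoc (f x) _ _))

  ∑-+ : ∀ (xs : List A) f g → ∑[ x ∈ xs ] (f x + g x) ≡ ∑ xs f + ∑ xs g
  ∑-+ []       f g = refl
  ∑-+ (x ∷ xs) f g = trans (cong (_+_ (f x + g x)) (∑-+ xs f g)) (interchange (f x) (g x) _ _)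
    where
    interchange : ∀ a b c d → a + b + (c + d) ≡ a + c + (b + d)
    interchange = solve-∀

  ∑-+₄ : ∀ (xs : List A) f₁ f₂ f₃ f₄ →
         ∑[ x ∈ xs ] (f₁ x + f₂ x + f₃ x + f₄ x) ≡ ∑ xs f₁ + ∑ xs f₂ + ∑ xs f₃ + ∑ xs f₄
  ∑-+₄ xs f₁ f₂ f₃ f₄ =
    trans (∑-+ xs (λ x → f₁ x + f₂ x + f₃ x) f₄)
    (cong (_+ ∑ xs f₄) (trans (∑-+ xs (λ x → f₁ x + f₂ x) f₃) (cong (_+ ∑ xs f₃) (∑-+ xs f₁ f₂))))

  ∑-*ˡ : ∀ (xs : List A) c f → ∑[ x ∈ xs ] (c * f x) ≡ c * ∑ xs f
  ∑-*ˡ []       c f = sym (*-zeroʳ c)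
  ∑-*ˡ (x ∷ xs) c f = trans (cong (_+_ (c * f x)) (∑-*ˡ xs c f)) (sym (*-distribˡ-+ c (f x) _))

  ∑-pos : ∀ (xs : List A) (f : A → ℕ) → + sum (map f xs) ≡ ∑[ x ∈ xs ] (+ f x)
  ∑-pos []       f = refl
  ∑-pos (x ∷ xs) f = cong (_+_ (+ f x)) (∑-pos xs f)

∑-linear : ∀ {A : Set} (xs : List A) f g c → ∑[ x ∈ xs ] (f x + c * g x) ≡ ∑ xs f + c * ∑ xs g
∑-linear xs f g c = trans (∑-+ xs f (λ x → c * g x)) (cong (_+_ (∑ xs f)) (∑-*ˡ xs c g))

∑-map : ∀ {A B : Set} (g : A → B) (xs : List A) f → ∑ (map g xs) f ≡ ∑ xs (f ∘ g)
∑-map g []       f = refl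
∑-map g (x ∷ xs) f = cong (_+_ (f (g x))) (∑-map g xs f)

∑-concat : ∀ {A : Set} (xss : List (List A)) f → ∑ (concat xss) f ≡ ∑[ xs ∈ xss ] ∑ xs f
∑-concat []         f = refl
∑-concat (xs ∷ xss) f = trans (∑-++ xs (concat xss) f) (cong (_+_ (∑ xs f)) (∑-concat xss f))

∑-comm : ∀ {A B : Set} (xs : List A) (ys : List B) (f : A → B → ℤ) →
         ∑[ x ∈ xs ] ∑ ys (f x) ≡ ∑[ y ∈ ys ] ∑[ x ∈ xs ] f x y
∑-comm []       ys f = sym (∑-zero ys)
∑-comm (x ∷ xs) ys f = trans (cong (_+_ (∑ ys (f x))) (∑-comm xs ys f)) (sym (∑-+ ys (f x) _))

𝟙 : Bool → ℤ
𝟙 true  = 1ℤ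
𝟙 false = 0ℤ

𝟙-guard : ∀ b {x y : ℤ} → (T b → x ≡ y) → 𝟙 b * x ≡ 𝟙 b * y
𝟙-guard true  x≡y = cong (1ℤ *_) (x≡y _)
𝟙-guard false _   = refl

∑-filter : ∀ {A : Set} (p : A → Bool) (xs : List A) f →
           ∑ (filter (λ x → T? (p x)) xs) f ≡ ∑[ x ∈ xs ] (𝟙 (p x) * f x)
∑-filter p []       f = refl
∑-filter p (x ∷ xs) f with p x
... | true  = cong₂ _+_ (sym (*-identityˡ (f x))) (∑-filter p xs f)
... | false = trans (∑-filter p xs f) (sym (+-identityˡ _))

∑-upTo-suc : ∀ n f → ∑ (upTo (suc n)) f ≡ f 0 + ∑[ i ∈ upTo n ] f (suc i)
∑-upTo-suc n f =
  cong (_+_ (f 0)) (trans (cong (λ is → ∑ is f) (sym (map-upTo suc n))) (∑-map suc (upTo n) f))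

∑-upTo-∷ʳ : ∀ n f → ∑ (upTo (suc n)) f ≡ ∑ (upTo n) f + f n
∑-upTo-∷ʳ n f = begin
  ∑ (upTo (suc n)) f        ≡⟨ cong (λ is → ∑ is f) (upTo-∷ʳ n) ⟨
  ∑ (upTo n ∷ʳ n) f         ≡⟨ ∑-++ (upTo n) [ n ] f ⟩
  ∑ (upTo n) f + (f n + 0ℤ) ≡⟨ cong (_+_ (∑ (upTo n) f)) (+-identityʳ (f n)) ⟩
  ∑ (upTo n) f + f n        ∎

∑-indicator : ∀ L y (f : ℕ → ℤ) → y < L → ∑[ i ∈ upTo L ] (f i * + (if y ≡ᵇ i then 1 else 0)) ≡ f y
∑-indicator (suc L) zero f _ = begin
  ∑[ i ∈ upTo (suc L) ] (f i * + (if 0 ≡ᵇ i then 1 else 0))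
    ≡⟨ ∑-upTo-suc L (λ i → f i * + (if 0 ≡ᵇ i then 1 else 0)) ⟩
  f 0 * 1ℤ + ∑[ i ∈ upTo L ] (f (suc i) * 0ℤ)
    ≡⟨ cong₂ _+_ (*-identityʳ (f 0)) (trans (∑-cong (upTo L) (*-zeroʳ ∘ f ∘ suc)) (∑-zero (upTo L))) ⟩
  f 0 + 0ℤ
    ≡⟨ +-identityʳ (f 0) ⟩
  f 0 ∎
∑-indicator (suc L) (suc y) f y<L = begin
  ∑[ i ∈ upTo (suc L) ] (f i * + (if suc y ≡ᵇ i then 1 else 0))
    ≡⟨ ∑-upTo-suc L (λ i → f i * + (if suc y ≡ᵇ i then 1 else 0)) ⟩
  f 0 * 0ℤ + ∑[ i ∈ upTo L ] (f (suc i) * + (if y ≡ᵇ i then 1 else 0))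
    ≡⟨ cong₂ _+_ (*-zeroʳ (f 0)) (∑-indicator L y (f ∘ suc) (s≤s⁻¹ y<L)) ⟩
  0ℤ + f (suc y)
    ≡⟨ +-identityˡ (f (suc y)) ⟩
  f (suc y) ∎

-- Sequences, read as generating functions

Seq : Set
Seq = ℕ → ℤ

delay : Seq → Seq
delay f zero    = 0ℤ
delay f (suc n) = f n

delay^ : ℕ → Seq → Seq
delay^ zero    f = f
delay^ (suc k) f = delay (delay^ k f)

Δ : Seq → Seq
Δ f n = f n - delay f n

Δ³ : Seq → Seq
Δ³ f = Δ (Δ (Δ f))

δ₀ : Seq
δ₀ zero    = 1ℤ
δ₀ (suc _) = 0ℤ

square : Seq
square n = + n * + n

delay-cong : ∀ {f g : Seq} → (∀ n → f n ≡ g n) → ∀ n → delay f n ≡ delay g n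
delay-cong f≗g zero    = refl
delay-cong f≗g (suc n) = f≗g n

delay-+ : ∀ (f g : Seq) n → delay (λ m → f m + g m) n ≡ delay f n + delay g n
delay-+ f g zero    = refl
delay-+ f g (suc n) = refl

delay-scale : ∀ c (f : Seq) n → delay (λ m → c * f m) n ≡ c * delay f n
delay-scale c f zero    = sym (*-zeroʳ c)
delay-scale c f (suc n) = refl

delay-∑ : ∀ {A : Set} (xs : List A) (F : A → Seq) n →
          delay (λ m → ∑[ x ∈ xs ] F x m) n ≡ ∑[ x ∈ xs ] delay (F x) n
delay-∑ xs F zero    = sym (∑-zero xs)
delay-∑ xs F (suc n) = refl

delay^-vanishing : ∀ {f : Seq} → (∀ n → f n ≡ 0ℤ) → ∀ k n → delay^ k f n ≡ 0ℤ
delay^-vanishing f≡0 zero    n       = f≡0 n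
delay^-vanishing f≡0 (suc k) zero    = refl
delay^-vanishing f≡0 (suc k) (suc n) = delay^-vanishing f≡0 k n

delay-Δ : ∀ f n → delay (Δ f) n ≡ Δ (delay f) n
delay-Δ f zero    = refl
delay-Δ f (suc n) = refl

Δ-cong : ∀ {f g : Seq} → (∀ n → f n ≡ g n) → ∀ n → Δ f n ≡ Δ g n
Δ-cong f≗g n = cong₂ _-_ (f≗g n) (delay-cong f≗g n)

Δ-scale : ∀ c (f : Seq) n → Δ (λ m → c * f m) n ≡ c * Δ f n
Δ-scale c f n = trans (cong (_-_ (c * f n)) (delay-scale c f n)) (factor c (f n) (delay f n))
  where
  factor : ∀ c a b → c * a - c * b ≡ c * (a - b)
  factor = solve-∀

Δ³-scale : ∀ c (f : Seq) n → Δ³ (λ m → c * f m) n ≡ c * Δ³ f n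
Δ³-scale c f n = trans (Δ-cong Δ²-scale n) (Δ-scale c (Δ (Δ f)) n)
  where
  Δ²-scale : ∀ n → Δ (Δ (λ m → c * f m)) n ≡ c * Δ (Δ f) n
  Δ²-scale n = trans (Δ-cong (Δ-scale c f) n) (Δ-scale c (Δ f) n)

Δ³-expand : ∀ f n → Δ³ f n ≡ f n - + 3 * delay f n + + 3 * delay^ 2 f n - delay^ 3 f n
Δ³-expand f n = begin
  Δ (Δ (Δ f)) n
    ≡⟨ cong (_-_ (Δ (Δ f) n)) (delay-Δ (Δ f) n) ⟩
  Δ (Δ f) n - Δ (delay (Δ f)) n
    ≡⟨ cong₂ _-_ (Δ²-expand f n) (Δ-cong (delay-Δ f) n) ⟩
  (f n - + 2 * delay f n + delay^ 2 f n) - Δ (Δ (delay f)) n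
    ≡⟨ cong (_-_ (f n - + 2 * delay f n + delay^ 2 f n)) (Δ²-expand (delay f) n) ⟩
  (f n - + 2 * delay f n + delay^ 2 f n) - (delay f n - + 2 * delay^ 2 f n + delay^ 3 f n)
    ≡⟨ collect (f n) (delay f n) (delay^ 2 f n) (delay^ 3 f n) ⟩
  f n - + 3 * delay f n + + 3 * delay^ 2 f n - delay^ 3 f n ∎
  where
  Δ²-expand : ∀ f n → Δ (Δ f) n ≡ f n - + 2 * delay f n + delay^ 2 f n
  Δ²-expand f n = trans (cong (_-_ (Δ f n)) (delay-Δ f n)) (expand (f n) (delay f n) (delay^ 2 f n))
    where
    expand : ∀ a b c → (a - b) - (b - c) ≡ a - + 2 * b + c
    expand = solve-∀
  collect : ∀ a b c d → (a - + 2 * b + c) - (b - + 2 * c + d) ≡ a - + 3 * b + + 3 * c - d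
  collect = solve-∀

Δ-injective : ∀ {f g : Seq} → (∀ n → Δ f n ≡ Δ g n) → ∀ n → f n ≡ g n
Δ-injective {f} {g} Δf≗Δg zero = begin
  f 0      ≡⟨ +-identityʳ (f 0) ⟨
  Δ f 0    ≡⟨ Δf≗Δg 0 ⟩
  Δ g 0    ≡⟨ +-identityʳ (g 0) ⟩
  g 0      ∎
Δ-injective {f} {g} Δf≗Δg (suc n) = begin
  f (suc n)               ≡⟨ add-back (f (suc n)) (f n) ⟨
  Δ f (suc n) + f n       ≡⟨ cong₂ _+_ (Δf≗Δg (suc n)) (Δ-injective {f} {g} Δf≗Δg n) ⟩
  Δ g (suc n) + g n       ≡⟨ add-back (g (suc n)) (g n) ⟩
  g (suc n)               ∎
  where
  add-back : ∀ a b → (a - b) + b ≡ a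
  add-back = solve-∀

Δ³-square : ∀ n → Δ³ square n ≡ delay δ₀ n + delay^ 2 δ₀ n
Δ³-square 0 = refl
Δ³-square 1 = refl
Δ³-square 2 = refl
Δ³-square (suc (suc (suc m))) = trans (Δ³-expand square (3 ℕ.+ m)) (third-difference (+ m))
  where
  third-difference : ∀ x → (+ 3 + x) * (+ 3 + x) - + 3 * ((+ 2 + x) * (+ 2 + x))
                           + + 3 * ((1ℤ + x) * (1ℤ + x)) - x * x ≡ 0ℤ + 0ℤ
  third-difference = solve-∀

Δ³-determines-square : ∀ {f : Seq} → (∀ n → Δ³ f n ≡ delay δ₀ n + delay^ 2 δ₀ n) → ∀ n → f n ≡ square n
Δ³-determines-square Δ³f = Δ-injective (Δ-injective (Δ-injective (λ n → trans (Δ³f n) (sym (Δ³-square n)))))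

-- Level recurrences

-- The first-step decomposition of a path from level y: its first step is u, h, d (each of
-- horizontal length 1) or v (length 0), only u or h at level 0, and s y is the weight
-- contributed by that first step.
record LevelRecurrence (F s : ℕ → Seq) : Set where
  field
    ground : ∀ N → F 0 N ≡ delay (F 1) N + s 0 N + delay (F 0) N
    above  : ∀ y N → F (suc y) N ≡ delay (F (suc (suc y))) N + s (suc y) N
                                   + delay (F (suc y)) N + delay (F y) N + F y N

open LevelRecurrence

cong-+₃ : ∀ {a a′ b b′ c c′ : ℤ} → a ≡ a′ → b ≡ b′ → c ≡ c′ → a + b + c ≡ a′ + b′ + c′
cong-+₃ refl refl refl = refl

cong-+₄ : ∀ {a a′ b b′ c c′ d d′ : ℤ} → a ≡ a′ → b ≡ b′ → c ≡ c′ → d ≡ d′ → a + b + c + d ≡ a′ + b′ + c′ + d′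
cong-+₄ refl refl refl refl = refl

cong-+₅ : ∀ {a a′ b b′ c c′ d d′ e e′ : ℤ} → a ≡ a′ → b ≡ b′ → c ≡ c′ → d ≡ d′ → e ≡ e′ →
          a + b + c + d + e ≡ a′ + b′ + c′ + d′ + e′
cong-+₅ refl refl refl refl refl = refl

private variable
  F G s t : ℕ → Seq

levelRecurrence-delay : LevelRecurrence F s → LevelRecurrence (delay ∘ F) (delay ∘ s)
levelRecurrence-delay rec .ground zero      = refl
levelRecurrence-delay rec .ground (suc N)   = rec .ground N
levelRecurrence-delay rec .above  y zero    = refl
levelRecurrence-delay rec .above  y (suc N) = rec .above y N

levelRecurrence-delay^ : ∀ k → LevelRecurrence F s → LevelRecurrence (delay^ k ∘ F) (delay^ k ∘ s)
levelRecurrence-delay^ zero    rec = rec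
levelRecurrence-delay^ (suc k) rec = levelRecurrence-delay (levelRecurrence-delay^ k rec)

levelRecurrence-Δ : LevelRecurrence F s → LevelRecurrence (Δ ∘ F) (Δ ∘ s)
levelRecurrence-Δ {F = F} {s = s} rec .ground N =
  trans (cong₂ _-_ (rec .ground N) (levelRecurrence-delay rec .ground N))
  (trans (difference₃ (delay (F 1) N) (s 0 N) (delay (F 0) N)
                      (delay (delay (F 1)) N) (delay (s 0) N) (delay (delay (F 0)) N))
  (sym (cong-+₃ (delay-Δ (F 1) N) refl (delay-Δ (F 0) N))))
  where
  difference₃ : ∀ a b c a′ b′ c′ → (a + b + c) - (a′ + b′ + c′) ≡ (a - a′) + (b - b′) + (c - c′)
  difference₃ = solve-∀
levelRecurrence-Δ {F = F} {s = s} rec .above y N =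
  trans (cong₂ _-_ (rec .above y N) (levelRecurrence-delay rec .above y N))
  (trans (difference₅ (delay (F (suc (suc y))) N) (s (suc y) N) (delay (F (suc y)) N) (delay (F y) N) (F y N)
                      (delay (delay (F (suc (suc y)))) N) (delay (s (suc y)) N) (delay (delay (F (suc y))) N)
                      (delay (delay (F y)) N) (delay (F y) N))
  (sym (cong-+₅ (delay-Δ (F (suc (suc y))) N) refl (delay-Δ (F (suc y)) N) (delay-Δ (F y) N) refl)))
  where
  difference₅ : ∀ a b c d e a′ b′ c′ d′ e′ →
    (a + b + c + d + e) - (a′ + b′ + c′ + d′ + e′) ≡ (a - a′) + (b - b′) + (c - c′) + (d - d′) + (e - e′)
  difference₅ = solve-∀

levelRecurrence-Δ³ : LevelRecurrence F s → LevelRecurrence (Δ³ ∘ F) (Δ³ ∘ s)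
levelRecurrence-Δ³ = levelRecurrence-Δ ∘ levelRecurrence-Δ ∘ levelRecurrence-Δ

levelRecurrence-homogeneous : LevelRecurrence F s → (∀ y N → s (suc y) N ≡ 0ℤ) → ∀ k y N →
  delay^ k (F (suc y)) N ≡ delay^ (suc k) (F (suc (suc y))) N + delay^ (suc k) (F (suc y)) N
                           + delay^ (suc k) (F y) N + delay^ k (F y) N
levelRecurrence-homogeneous {F = F} rec s≡0 k y N =
  trans (levelRecurrence-delay^ k rec .above y N)
  (cong (λ a → a + delay^ (suc k) (F (suc y)) N + delay^ (suc k) (F y) N + delay^ k (F y) N)
        (trans (cong (_+_ u₂) (delay^-vanishing (s≡0 y) k N)) (+-identityʳ u₂)))
  where
  u₂ = delay^ (suc k) (F (suc (suc y))) N

levelRecurrence-unique : LevelRecurrence F s → LevelRecurrence G t →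
                         (∀ y N → s y N ≡ t y N) → ∀ N y → F y N ≡ G y N
levelRecurrence-unique {F = F} {G = G} F-rec G-rec s≗t = go
  where
  go : ∀ N y → F y N ≡ G y N
  go zero zero =
    trans (F-rec .ground 0) (trans (cong (λ z → 0ℤ + z + 0ℤ) (s≗t 0 0)) (sym (G-rec .ground 0)))
  go zero (suc y) =
    trans (F-rec .above y 0)
    (trans (cong₂ (λ a b → 0ℤ + a + 0ℤ + 0ℤ + b) (s≗t (suc y) 0) (go zero y)) (sym (G-rec .above y 0)))
  go (suc n) zero =
    trans (F-rec .ground (suc n))
    (trans (cong-+₃ (go n 1) (s≗t 0 (suc n)) (go n 0)) (sym (G-rec .ground (suc n))))
  go (suc n) (suc y) =
    trans (F-rec .above y (suc n))
    (trans (cong-+₅ (go n (suc (suc y))) (s≗t (suc y) (suc n)) (go n (suc y)) (go n y) (go (suc n) y))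
           (sym (G-rec .above y (suc n))))

groundOnly : Seq → ℕ → Seq
groundOnly f zero    N = f N
groundOnly f (suc _) N = 0ℤ

weight : ℕ → ℤ
weight i = signℤ i * + ((i ℕ.+ 2) C 2)

signℤ-double : ∀ m → signℤ (m ℕ.+ m) ≡ 1ℤ
signℤ-double zero    = refl
signℤ-double (suc m) = begin
  signℤ (suc (m ℕ.+ suc m))  ≡⟨ cong (signℤ ∘ suc) (ℕₚ.+-suc m m) ⟩
  - - signℤ (m ℕ.+ m)        ≡⟨ neg-involutive _ ⟩
  signℤ (m ℕ.+ m)            ≡⟨ signℤ-double m ⟩
  1ℤ                         ∎

twice-choose-2 : ∀ n → 2 ℕ.* ((n ℕ.+ 2) C 2) ≡ (n ℕ.+ 2) ℕ.* (n ℕ.+ 1)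
twice-choose-2 zero    = refl
twice-choose-2 (suc n) = begin
  2 ℕ.* ((suc n ℕ.+ 2) C 2)                   ≡⟨ cong (2 ℕ.*_) (nCk+nC[k+1]≡[n+1]C[k+1] (n ℕ.+ 2) 1) ⟨
  2 ℕ.* ((n ℕ.+ 2) C 1 ℕ.+ (n ℕ.+ 2) C 2)     ≡⟨ cong (λ c → 2 ℕ.* (c ℕ.+ (n ℕ.+ 2) C 2)) (nC1≡n (n ℕ.+ 2)) ⟩
  2 ℕ.* (n ℕ.+ 2 ℕ.+ (n ℕ.+ 2) C 2)           ≡⟨ ℕₚ.*-distribˡ-+ 2 (n ℕ.+ 2) _ ⟩
  2 ℕ.* (n ℕ.+ 2) ℕ.+ 2 ℕ.* ((n ℕ.+ 2) C 2)   ≡⟨ cong (2 ℕ.* (n ℕ.+ 2) ℕ.+_) (twice-choose-2 n) ⟩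
  2 ℕ.* (n ℕ.+ 2) ℕ.+ (n ℕ.+ 2) ℕ.* (n ℕ.+ 1) ≡⟨ pascal n ⟩
  (suc n ℕ.+ 2) ℕ.* (suc n ℕ.+ 1)             ∎
  where
  pascal : ∀ n → 2 ℕ.* (n ℕ.+ 2) ℕ.+ (n ℕ.+ 2) ℕ.* (n ℕ.+ 1) ≡ (suc n ℕ.+ 2) ℕ.* (suc n ℕ.+ 1)
  pascal = ℕ-Solver.solve-∀

choose-2-odd : ∀ m → (suc (m ℕ.+ m) ℕ.+ 2) C 2 ≡ (1 ℕ.+ m) ℕ.* (3 ℕ.+ 2 ℕ.* m)
choose-2-odd m = ℕₚ.*-cancelˡ-≡ _ _ 2 (trans (twice-choose-2 (suc (m ℕ.+ m))) (expand m))
  where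
  expand : ∀ m → (suc (m ℕ.+ m) ℕ.+ 2) ℕ.* (suc (m ℕ.+ m) ℕ.+ 1) ≡ 2 ℕ.* ((1 ℕ.+ m) ℕ.* (3 ℕ.+ 2 ℕ.* m))
  expand = ℕ-Solver.solve-∀

choose-2-even : ∀ m → (suc (suc (m ℕ.+ m)) ℕ.+ 2) C 2 ≡ (2 ℕ.+ m) ℕ.* (3 ℕ.+ 2 ℕ.* m)
choose-2-even m = ℕₚ.*-cancelˡ-≡ _ _ 2 (trans (twice-choose-2 (suc (suc (m ℕ.+ m)))) (expand m))
  where
  expand : ∀ m → (suc (suc (m ℕ.+ m)) ℕ.+ 2) ℕ.* (suc (suc (m ℕ.+ m)) ℕ.+ 1) ≡ 2 ℕ.* ((2 ℕ.+ m) ℕ.* (3 ℕ.+ 2 ℕ.* m))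
  expand = ℕ-Solver.solve-∀

pos-linear-product : ∀ a m → + ((a ℕ.+ m) ℕ.* (3 ℕ.+ 2 ℕ.* m)) ≡ (+ a + + m) * (+ 3 + + 2 * + m)
pos-linear-product a m =
  trans (pos-* (a ℕ.+ m) (3 ℕ.+ 2 ℕ.* m)) (cong (λ k → + (a ℕ.+ m) * (+ 3 + k)) (pos-* 2 m))

weight-odd : ∀ m → weight (suc (m ℕ.+ m)) ≡ - ((1ℤ + + m) * (+ 3 + + 2 * + m))
weight-odd m = begin
  - signℤ (m ℕ.+ m) * + c
    ≡⟨ cong (λ σ → - σ * + c) (signℤ-double m) ⟩
  -1ℤ * + c
    ≡⟨ -1*i≡-i (+ c) ⟩
  - + c
    ≡⟨ cong -_ (trans (cong +_ (choose-2-odd m)) (pos-linear-product 1 m)) ⟩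
  - ((1ℤ + + m) * (+ 3 + + 2 * + m)) ∎
  where
  c = (suc (m ℕ.+ m) ℕ.+ 2) C 2

weight-even : ∀ m → weight (suc (suc (m ℕ.+ m))) ≡ (+ 2 + + m) * (+ 3 + + 2 * + m)
weight-even m = begin
  - - signℤ (m ℕ.+ m) * + c
    ≡⟨ cong (_* + c) (trans (neg-involutive _) (signℤ-double m)) ⟩
  1ℤ * + c
    ≡⟨ *-identityˡ (+ c) ⟩
  + c
    ≡⟨ trans (cong +_ (choose-2-even m)) (pos-linear-product 2 m) ⟩
  (+ 2 + + m) * (+ 3 + + 2 * + m) ∎
  where
  c = (suc (suc (m ℕ.+ m)) ℕ.+ 2) C 2

-- The closed form

parity-double : ∀ m → parity (m ℕ.+ m) ≡ 0ℙ
parity-double zero    = refl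
parity-double (suc m) = trans (cong (parity ∘ suc) (ℕₚ.+-suc m m)) (parity-double m)

parity-double+1 : ∀ m → parity (suc (m ℕ.+ m)) ≡ 1ℙ
parity-double+1 zero    = refl
parity-double+1 (suc m) = trans (cong parity (ℕₚ.+-suc m m)) (parity-double+1 m)

-- INLINE lets the ring solver see through these definitions.
evenForm oddForm : (m p₁ p₃ q₁ q₂ q₃ : ℤ) → ℤ
evenForm m p₁ p₃ q₁ q₂ q₃ = (1ℤ + m) * (p₁ - p₃) - (q₂ + q₃) + m * (1ℤ + m) * (q₁ - + 2 * q₂ + q₃)
oddForm  m p₁ p₃ q₁ q₂ q₃ = - ((1ℤ + m) * (p₁ - p₃)) - (1ℤ + m) * (1ℤ + m) * (q₁ - + 2 * q₂ + q₃)
{-# INLINE evenForm #-}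
{-# INLINE oddForm #-}

-- With x acting as delay, closedForm 0ℙ m P Q is (1+m)(x - x³) P - (x² + x³) Q + m(1+m) x(1-x)² Q
-- and closedForm 1ℙ m P Q is -(1+m)(x - x³) P - (1+m)² x(1-x)² Q. For m = ⌊y/2⌋ and P, Q the path
-- counts from levels y and y + 1 this is the closed form of (1-x)³ times the weighted path
-- sum from level y.
closedForm : Parity → ℤ → Seq → Seq → Seq
closedForm 0ℙ m P Q N = evenForm m (delay P N) (delay^ 3 P N) (delay Q N) (delay^ 2 Q N) (delay^ 3 Q N)
closedForm 1ℙ m P Q N = oddForm  m (delay P N) (delay^ 3 P N) (delay Q N) (delay^ 2 Q N) (delay^ 3 Q N)

delay-closedForm : ∀ p m P Q N → delay (closedForm p m P Q) N ≡ closedForm p m (delay P) (delay Q) N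
delay-closedForm 0ℙ m P Q zero    = sym (vanishes m)
  where
  vanishes : ∀ m → evenForm m 0ℤ 0ℤ 0ℤ 0ℤ 0ℤ ≡ 0ℤ
  vanishes = solve-∀
delay-closedForm 1ℙ m P Q zero    = sym (vanishes m)
  where
  vanishes : ∀ m → oddForm m 0ℤ 0ℤ 0ℤ 0ℤ 0ℤ ≡ 0ℤ
  vanishes = solve-∀
delay-closedForm 0ℙ m P Q (suc N) = refl
delay-closedForm 1ℙ m P Q (suc N) = refl

ground-identity : ∀ (a₁ a₂ a₃ a₄ b₁ b₂ b₃ b₄ c₂ c₃ c₄ : ℤ) →
  b₁ ≡ c₂ + b₂ + a₂ + a₁ → b₂ ≡ c₃ + b₃ + a₃ + a₂ → b₃ ≡ c₄ + b₄ + a₄ + a₃ →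
  evenForm 0ℤ a₁ a₃ b₁ b₂ b₃
    ≡ oddForm 0ℤ b₂ b₄ c₂ c₃ c₄ + 1ℤ * (b₁ - + 3 * b₂ + + 3 * b₃ - b₄) + evenForm 0ℤ a₂ a₄ b₂ b₃ b₄
ground-identity a₁ a₂ a₃ a₄ _ _ _ b₄ c₂ c₃ c₄ refl refl refl =
  solve (a₁ ∷ a₂ ∷ a₃ ∷ a₄ ∷ b₄ ∷ c₂ ∷ c₃ ∷ c₄ ∷ [])

odd-level-identity : ∀ (m g a₁ a₂ a₃ a₄ b₁ b₂ b₃ b₄ c₁ c₂ c₃ c₄ d₂ d₃ d₄ : ℤ) →
  g ≡ - ((1ℤ + m) * (+ 3 + + 2 * m)) →
  c₁ ≡ d₂ + c₂ + b₂ + b₁ → b₁ ≡ c₂ + b₂ + a₂ + a₁ → c₂ ≡ d₃ + c₃ + b₃ + b₂ →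
  c₃ ≡ d₄ + c₄ + b₄ + b₃ → b₃ ≡ c₄ + b₄ + a₄ + a₃ →
  oddForm m b₁ b₃ c₁ c₂ c₃
    ≡ evenForm (1ℤ + m) c₂ c₄ d₂ d₃ d₄ + g * (c₁ - + 3 * c₂ + + 3 * c₃ - c₄)
      + oddForm m b₂ b₄ c₂ c₃ c₄ + evenForm m a₂ a₄ b₂ b₃ b₄ + evenForm m a₁ a₃ b₁ b₂ b₃
odd-level-identity m _ a₁ a₂ a₃ a₄ _ b₂ _ b₄ _ _ _ c₄ d₂ d₃ d₄ refl refl refl refl refl refl =
  solve (m ∷ a₁ ∷ a₂ ∷ a₃ ∷ a₄ ∷ b₂ ∷ b₄ ∷ c₄ ∷ d₂ ∷ d₃ ∷ d₄ ∷ [])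

even-level-identity : ∀ (m g a₁ a₂ a₃ a₄ b₁ b₂ b₃ b₄ c₁ c₂ c₃ c₄ d₂ d₃ d₄ : ℤ) →
  g ≡ (+ 2 + m) * (+ 3 + + 2 * m) →
  c₁ ≡ d₂ + c₂ + b₂ + b₁ → b₁ ≡ c₂ + b₂ + a₂ + a₁ → c₂ ≡ d₃ + c₃ + b₃ + b₂ →
  c₃ ≡ d₄ + c₄ + b₄ + b₃ → b₃ ≡ c₄ + b₄ + a₄ + a₃ →
  evenForm (1ℤ + m) b₁ b₃ c₁ c₂ c₃
    ≡ oddForm (1ℤ + m) c₂ c₄ d₂ d₃ d₄ + g * (c₁ - + 3 * c₂ + + 3 * c₃ - c₄)
      + evenForm (1ℤ + m) b₂ b₄ c₂ c₃ c₄ + oddForm m a₂ a₄ b₂ b₃ b₄ + oddForm m a₁ a₃ b₁ b₂ b₃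
even-level-identity m _ a₁ a₂ a₃ a₄ _ b₂ _ b₄ _ _ _ c₄ d₂ d₃ d₄ refl refl refl refl refl refl =
  solve (m ∷ a₁ ∷ a₂ ∷ a₃ ∷ a₄ ∷ b₂ ∷ b₄ ∷ c₄ ∷ d₂ ∷ d₃ ∷ d₄ ∷ [])

ground-value-identity : ∀ (a₁ a₂ a₃ b₁ b₂ b₃ δ₁ δ₂ : ℤ) →
  a₁ ≡ b₂ + δ₁ + a₂ → a₂ ≡ b₃ + δ₂ + a₃ → evenForm 0ℤ a₁ a₃ b₁ b₂ b₃ ≡ δ₁ + δ₂
ground-value-identity _ _ a₃ b₁ b₂ b₃ δ₁ δ₂ refl refl = solve (a₃ ∷ b₁ ∷ b₂ ∷ b₃ ∷ δ₁ ∷ δ₂ ∷ [])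

halve : ∀ n → (Σ ℕ λ m → n ≡ m ℕ.+ m) ⊎ (Σ ℕ λ m → n ≡ suc (m ℕ.+ m))
halve zero = inj₁ (0 , refl)
halve (suc n) with halve n
... | inj₁ (m , n≡m+m)   = inj₂ (m , cong suc n≡m+m)
... | inj₂ (m , n≡1+m+m) = inj₁ (suc m , trans (cong suc n≡1+m+m) (cong suc (sym (ℕₚ.+-suc m m))))

module ClosedForm {count : ℕ → Seq} (count-rec : LevelRecurrence count (groundOnly δ₀)) where

  K : ℕ → Seq
  K y = closedForm (parity y) (+ ⌊ y /2⌋) (count y) (count (suc y))

  source : ℕ → Seq
  source y N = weight y * Δ³ (delay (count (suc y))) N

  private
    K-at : ∀ y {p m} → parity y ≡ p → ⌊ y /2⌋ ≡ m → ∀ N →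
           K y N ≡ closedForm p (+ m) (count y) (count (suc y)) N
    K-at y refl refl N = refl

    delay-K-at : ∀ y {p m} → parity y ≡ p → ⌊ y /2⌋ ≡ m → ∀ N →
                 delay (K y) N ≡ closedForm p (+ m) (delay (count y)) (delay (count (suc y))) N
    delay-K-at y {p} {m} py hy N =
      trans (delay-cong (K-at y py hy) N) (delay-closedForm p (+ m) (count y) (count (suc y)) N)

    source-expand : ∀ y N → source y N ≡ weight y * (delay^ 1 (count (suc y)) N - + 3 * delay^ 2 (count (suc y)) N
                                                     + + 3 * delay^ 3 (count (suc y)) N - delay^ 4 (count (suc y)) N)
    source-expand y N = cong (weight y *_) (Δ³-expand (delay (count (suc y))) N)

    count-above : ∀ k y N → delay^ k (count (suc y)) N
      ≡ delay^ (suc k) (count (suc (suc y))) N + delay^ (suc k) (count (suc y)) N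
        + delay^ (suc k) (count y) N + delay^ k (count y) N
    count-above = levelRecurrence-homogeneous count-rec (λ _ _ → refl)

  closedForm-recurrence : LevelRecurrence K source
  closedForm-recurrence .ground N =
    trans (ground-identity (val 0 1) (val 0 2) (val 0 3) (val 0 4) (val 1 1) (val 1 2) (val 1 3) (val 1 4)
                           (val 2 2) (val 2 3) (val 2 4) (count-above 1 0 N) (count-above 2 0 N) (count-above 3 0 N))
    (sym (cong-+₃ (delay-K-at 1 refl refl N) (source-expand 0 N) (delay-K-at 0 refl refl N)))
    where
    val : ℕ → ℕ → ℤ
    val j k = delay^ k (count j) N
  closedForm-recurrence .above y N = step (halve y)
    where
    val : ℕ → ℕ → ℤ
    val j k = delay^ k (count (j ℕ.+ y)) N

    step : (Σ ℕ λ m → y ≡ m ℕ.+ m) ⊎ (Σ ℕ λ m → y ≡ suc (m ℕ.+ m)) →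
           K (suc y) N ≡ delay (K (suc (suc y))) N + source (suc y) N + delay (K (suc y)) N + delay (K y) N + K y N
    step (inj₁ (m , y≡m+m)) =
      trans (K-at (suc y) odd-parity odd-half N)
      (trans (odd-level-identity (+ m) (weight (suc y))
                (val 0 1) (val 0 2) (val 0 3) (val 0 4) (val 1 1) (val 1 2) (val 1 3) (val 1 4)
                (val 2 1) (val 2 2) (val 2 3) (val 2 4) (val 3 2) (val 3 3) (val 3 4)
                (trans (cong (weight ∘ suc) y≡m+m) (weight-odd m))
                (count-above 1 (suc y) N) (count-above 1 y N) (count-above 2 (suc y) N)
                (count-above 3 (suc y) N) (count-above 3 y N))
      (sym (cong-+₅ (delay-K-at (suc (suc y)) even-parity (cong suc even-half) N) (source-expand (suc y) N)
                    (delay-K-at (suc y) odd-parity odd-half N) (delay-K-at y even-parity even-half N)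
                    (K-at y even-parity even-half N))))
      where
      even-parity : parity y ≡ 0ℙ
      even-parity = trans (cong parity y≡m+m) (parity-double m)
      even-half : ⌊ y /2⌋ ≡ m
      even-half = trans (cong ⌊_/2⌋ y≡m+m) (sym (ℕₚ.n≡⌊n+n/2⌋ m))
      odd-parity : parity (suc y) ≡ 1ℙ
      odd-parity = trans (cong (parity ∘ suc) y≡m+m) (parity-double+1 m)
      odd-half : ⌊ suc y /2⌋ ≡ m
      odd-half = trans (cong (⌊_/2⌋ ∘ suc) y≡m+m) (sym (ℕₚ.n≡⌈n+n/2⌉ m))
    step (inj₂ (m , y≡1+m+m)) =
      trans (K-at (suc y) even-parity even-half N)
      (trans (even-level-identity (+ m) (weight (suc y))
                (val 0 1) (val 0 2) (val 0 3) (val 0 4) (val 1 1) (val 1 2) (val 1 3) (val 1 4)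
                (val 2 1) (val 2 2) (val 2 3) (val 2 4) (val 3 2) (val 3 3) (val 3 4)
                (trans (cong (weight ∘ suc) y≡1+m+m) (weight-even m))
                (count-above 1 (suc y) N) (count-above 1 y N) (count-above 2 (suc y) N)
                (count-above 3 (suc y) N) (count-above 3 y N))
      (sym (cong-+₅ (delay-K-at (suc (suc y)) odd-parity (cong suc odd-half) N) (source-expand (suc y) N)
                    (delay-K-at (suc y) even-parity even-half N) (delay-K-at y odd-parity odd-half N)
                    (K-at y odd-parity odd-half N))))
      where
      odd-parity : parity y ≡ 1ℙ
      odd-parity = trans (cong parity y≡1+m+m) (parity-double+1 m)
      odd-half : ⌊ y /2⌋ ≡ m
      odd-half = trans (cong ⌊_/2⌋ y≡1+m+m) (sym (ℕₚ.n≡⌈n+n/2⌉ m))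
      even-parity : parity (suc y) ≡ 0ℙ
      even-parity = trans (cong (parity ∘ suc) y≡1+m+m) (parity-double m)
      even-half : ⌊ suc y /2⌋ ≡ suc m
      even-half = trans (cong (⌊_/2⌋ ∘ suc) y≡1+m+m) (cong suc (sym (ℕₚ.n≡⌊n+n/2⌋ m)))

  closedForm-ground : ∀ N → K 0 N ≡ delay δ₀ N + delay^ 2 δ₀ N
  closedForm-ground N =
    ground-value-identity (delay^ 1 (count 0) N) (delay^ 2 (count 0) N) (delay^ 3 (count 0) N)
                          (delay^ 1 (count 1) N) (delay^ 2 (count 1) N) (delay^ 3 (count 1) N)
                          (delay^ 1 δ₀ N) (delay^ 2 δ₀ N)
                          (levelRecurrence-delay^ 1 count-rec .ground N)
                          (levelRecurrence-delay^ 2 count-rec .ground N)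

weighted₀≡square : ∀ {count weighted : ℕ → Seq} → LevelRecurrence count (groundOnly δ₀) →
  LevelRecurrence weighted (λ y N → weight y * delay (count (suc y)) N) → ∀ N → weighted 0 N ≡ square N
weighted₀≡square {count} {weighted} count-rec weighted-rec = Δ³-determines-square Δ³-weighted₀
  where
  open ClosedForm count-rec
  Δ³-weighted₀ : ∀ N → Δ³ (weighted 0) N ≡ delay δ₀ N + delay^ 2 δ₀ N
  Δ³-weighted₀ N = trans (levelRecurrence-unique (levelRecurrence-Δ³ weighted-rec) closedForm-recurrence
                           (λ y → Δ³-scale (weight y) (delay (count (suc y)))) N 0)
                         (closedForm-ground N)

-- Sums over paths

isPathFrom : ℕ → ℕ → List Step → Bool
isPathFrom y N w = (xlen w ≡ᵇ N) ∧ validFrom y w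

pathSumOfLength : (List Step → ℤ) → ℕ → ℕ → Seq
pathSumOfLength ψ k y N = ∑[ w ∈ wordsOfLength k ] (𝟙 (isPathFrom y N w) * ψ w)

pathSum≤ : (List Step → ℤ) → ℕ → ℕ → Seq
pathSum≤ ψ K y N = ∑[ k ∈ upTo (suc K) ] pathSumOfLength ψ k y N

-- A path from level y of horizontal length N has N non-vertical steps and at most N + y
-- vertical ones.
pathBound : ℕ → ℕ → ℕ
pathBound N y = N ℕ.+ N ℕ.+ y

pathSum : (List Step → ℤ) → ℕ → Seq
pathSum ψ y N = pathSum≤ ψ (pathBound N y) y N

pathBound-level : ∀ N y → pathBound N y < pathBound N (suc y)
pathBound-level N y = ℕₚ.≤-reflexive (sym (ℕₚ.+-suc (N ℕ.+ N) y))

pathBound-step : ∀ n {y y′} → y′ ≤ suc y → pathBound n y′ < pathBound (suc n) y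
pathBound-step n {y} y′≤1+y = s≤s (ℕₚ.≤-trans (ℕₚ.+-monoʳ-≤ (n ℕ.+ n) y′≤1+y) (ℕₚ.≤-reflexive shift))
  where
  shift : n ℕ.+ n ℕ.+ suc y ≡ n ℕ.+ suc n ℕ.+ y
  shift = trans (ℕₚ.+-suc (n ℕ.+ n) y) (cong (ℕ._+ y) (sym (ℕₚ.+-suc n n)))

firstStepSum : (List Step → ℤ) → ℕ → ℕ → ℕ → Step → ℤ
firstStepSum ψ k y N s = ∑[ w ∈ wordsOfLength k ] (𝟙 (isPathFrom y N (s ∷ w)) * ψ (s ∷ w))

pathSumOfLength-suc : ∀ ψ k y N →
  pathSumOfLength ψ (suc k) y N ≡ ∑[ s ∈ u ∷ d ∷ h ∷ v ∷ [] ] firstStepSum ψ k y N s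
pathSumOfLength-suc ψ k y N =
  trans (∑-concat (map prepend steps) f)
  (trans (∑-map prepend steps (λ ws → ∑ ws f)) (∑-cong steps (λ s → ∑-map (s ∷_) (wordsOfLength k) f)))
  where
  steps = u ∷ d ∷ h ∷ v ∷ []
  prepend : Step → List (List Step)
  prepend s = map (s ∷_) (wordsOfLength k)
  f : List Step → ℤ
  f w = 𝟙 (isPathFrom y N w) * ψ w

validFrom-u : ∀ y w → validFrom y (u ∷ w) ≡ validFrom (suc y) w
validFrom-u zero    w = refl
validFrom-u (suc y) w = refl

validFrom-h : ∀ y w → validFrom y (h ∷ w) ≡ validFrom y w
validFrom-h zero    w = refl
validFrom-h (suc y) w = refl

firstStepSum-nonvertical : ∀ ψ k s y y′ → width s ≡ 1 → (∀ w → validFrom y (s ∷ w) ≡ validFrom y′ w) →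
  ∀ N → firstStepSum ψ k y N s ≡ delay (pathSumOfLength (ψ ∘ (s ∷_)) k y′) N
firstStepSum-nonvertical ψ k s y y′ width≡1 valid zero =
  trans (∑-cong (wordsOfLength k) vanish) (∑-zero (wordsOfLength k))
  where
  vanish : ∀ w → 𝟙 (isPathFrom y 0 (s ∷ w)) * ψ (s ∷ w) ≡ 0ℤ
  vanish w = cong (λ l → 𝟙 ((l ℕ.+ xlen w ≡ᵇ 0) ∧ validFrom y (s ∷ w)) * ψ (s ∷ w)) width≡1
firstStepSum-nonvertical ψ k s y y′ width≡1 valid (suc N) = ∑-cong (wordsOfLength k) shift
  where
  shift : ∀ w → 𝟙 (isPathFrom y (suc N) (s ∷ w)) * ψ (s ∷ w) ≡ 𝟙 (isPathFrom y′ N w) * ψ (s ∷ w)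
  shift w = cong₂ (λ l b → 𝟙 ((l ℕ.+ xlen w ≡ᵇ suc N) ∧ b) * ψ (s ∷ w)) width≡1 (valid w)

firstStepSum-forbidden : ∀ ψ k s N → (∀ w → validFrom 0 (s ∷ w) ≡ false) → firstStepSum ψ k 0 N s ≡ 0ℤ
firstStepSum-forbidden ψ k s N invalid = trans (∑-cong (wordsOfLength k) vanish) (∑-zero (wordsOfLength k))
  where
  vanish : ∀ w → 𝟙 (isPathFrom 0 N (s ∷ w)) * ψ (s ∷ w) ≡ 0ℤ
  vanish w = cong (λ b → 𝟙 b * ψ (s ∷ w))
                  (trans (cong ((xlen (s ∷ w) ≡ᵇ N) ∧_) (invalid w)) (∧-zeroʳ _))

pathSumOfLength-ground : ∀ ψ k N → pathSumOfLength ψ (suc k) 0 N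
  ≡ delay (pathSumOfLength (ψ ∘ (u ∷_)) k 1) N + delay (pathSumOfLength (ψ ∘ (h ∷_)) k 0) N
pathSumOfLength-ground ψ k N = begin
  pathSumOfLength ψ (suc k) 0 N          ≡⟨ pathSumOfLength-suc ψ k 0 N ⟩
  step u + (step d + (step h + (step v + 0ℤ)))
    ≡⟨ cong₂ (λ x z → step u + (x + (step h + (z + 0ℤ))))
             (firstStepSum-forbidden ψ k d N (λ _ → refl)) (firstStepSum-forbidden ψ k v N (λ _ → refl)) ⟩
  step u + (0ℤ + (step h + (0ℤ + 0ℤ)))   ≡⟨ drop-zeros (step u) (step h) ⟩
  step u + step h                        ≡⟨ cong₂ _+_ (firstStepSum-nonvertical ψ k u 0 1 refl (validFrom-u 0) N)
                                                      (firstStepSum-nonvertical ψ k h 0 0 refl (validFrom-h 0) N) ⟩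
  delay (pathSumOfLength (ψ ∘ (u ∷_)) k 1) N + delay (pathSumOfLength (ψ ∘ (h ∷_)) k 0) N ∎
  where
  step = firstStepSum ψ k 0 N
  drop-zeros : ∀ a b → a + (0ℤ + (b + (0ℤ + 0ℤ))) ≡ a + b
  drop-zeros = solve-∀

pathSumOfLength-above : ∀ ψ k y N → pathSumOfLength ψ (suc k) (suc y) N
  ≡ delay (pathSumOfLength (ψ ∘ (u ∷_)) k (suc (suc y))) N + delay (pathSumOfLength (ψ ∘ (h ∷_)) k (suc y)) N
    + delay (pathSumOfLength (ψ ∘ (d ∷_)) k y) N + pathSumOfLength (ψ ∘ (v ∷_)) k y N
pathSumOfLength-above ψ k y N =
  trans (pathSumOfLength-suc ψ k (suc y) N)
  (trans (reorder (step u) (step d) (step h) (step v))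
  (cong-+₄ (firstStepSum-nonvertical ψ k u (suc y) (suc (suc y)) refl (validFrom-u (suc y)) N)
           (firstStepSum-nonvertical ψ k h (suc y) (suc y) refl (validFrom-h (suc y)) N)
           (firstStepSum-nonvertical ψ k d (suc y) y refl (λ _ → refl) N)
           refl))
  where
  step = firstStepSum ψ k (suc y) N
  reorder : ∀ a b c e → a + (b + (c + (e + 0ℤ))) ≡ a + c + b + e
  reorder = solve-∀

pathSumOfLength-vanishes : ∀ ψ k y N → pathBound N y < k → pathSumOfLength ψ k y N ≡ 0ℤ
pathSumOfLength-vanishes ψ (suc k) y N = first-step y
  where
  delayed : ∀ {Y} ψ′ y′ M → y′ ≤ suc Y → pathBound M Y < suc k → delay (pathSumOfLength ψ′ k y′) M ≡ 0ℤ
  delayed ψ′ y′ zero    _       _         = refl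
  delayed ψ′ y′ (suc n) y′≤1+Y bound<1+k =
    pathSumOfLength-vanishes ψ′ k y′ n (ℕₚ.<-≤-trans (pathBound-step n y′≤1+Y) (s≤s⁻¹ bound<1+k))

  first-step : ∀ y → pathBound N y < suc k → pathSumOfLength ψ (suc k) y N ≡ 0ℤ
  first-step zero    bound<1+k =
    trans (pathSumOfLength-ground ψ k N)
          (cong₂ _+_ (delayed {0} _ 1 N ℕₚ.≤-refl bound<1+k) (delayed {0} _ 0 N z≤n bound<1+k))
  first-step (suc y) bound<1+k =
    trans (pathSumOfLength-above ψ k y N)
          (cong-+₄ (delayed {suc y} _ (suc (suc y)) N ℕₚ.≤-refl bound<1+k)
                   (delayed {suc y} _ (suc y) N (ℕₚ.n≤1+n _) bound<1+k)
                   (delayed {suc y} _ y N (ℕₚ.m≤n+m y 2) bound<1+k)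
                   (pathSumOfLength-vanishes _ k y N (ℕₚ.<-≤-trans (pathBound-level N y) (s≤s⁻¹ bound<1+k))))

pathSum≤-stable : ∀ ψ y N {K} → pathBound N y ≤ K → pathSum≤ ψ K y N ≡ pathSum ψ y N
pathSum≤-stable ψ y N bound≤K = stable (ℕₚ.≤⇒≤′ bound≤K)
  where
  stable : ∀ {K} → pathBound N y ≤′ K → pathSum≤ ψ K y N ≡ pathSum ψ y N
  stable ≤′-refl              = refl
  stable (≤′-step {K} bound≤K) = begin
    pathSum≤ ψ (suc K) y N                           ≡⟨ ∑-upTo-∷ʳ (suc K) (λ k → pathSumOfLength ψ k y N) ⟩
    pathSum≤ ψ K y N + pathSumOfLength ψ (suc K) y N ≡⟨ cong (_+_ (pathSum≤ ψ K y N)) vanishes ⟩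
    pathSum≤ ψ K y N + 0ℤ                            ≡⟨ +-identityʳ _ ⟩
    pathSum≤ ψ K y N                                 ≡⟨ stable bound≤K ⟩
    pathSum ψ y N                                    ∎
    where
    vanishes = pathSumOfLength-vanishes ψ (suc K) y N (s≤s (ℕₚ.≤′⇒≤ bound≤K))

pathSum≤-ground : ∀ ψ K N → pathSum≤ ψ (suc K) 0 N
  ≡ delay (pathSum≤ (ψ ∘ (u ∷_)) K 1) N + δ₀ N * ψ [] + delay (pathSum≤ (ψ ∘ (h ∷_)) K 0) N
pathSum≤-ground ψ K N = begin
  pathSum≤ ψ (suc K) 0 N
    ≡⟨ ∑-upTo-suc (suc K) (λ k → pathSumOfLength ψ k 0 N) ⟩
  pathSumOfLength ψ 0 0 N + ∑[ k ∈ upTo (suc K) ] pathSumOfLength ψ (suc k) 0 N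
    ≡⟨ cong₂ _+_ (empty N) (∑-cong (upTo (suc K)) (λ k → pathSumOfLength-ground ψ k N)) ⟩
  δ₀ N * ψ [] + ∑[ k ∈ upTo (suc K) ] (delay (U k) N + delay (H k) N)
    ≡⟨ cong (_+_ (δ₀ N * ψ [])) (trans (∑-+ (upTo (suc K)) (λ k → delay (U k) N) (λ k → delay (H k) N))
         (cong₂ _+_ (sym (delay-∑ (upTo (suc K)) U N)) (sym (delay-∑ (upTo (suc K)) H N)))) ⟩
  δ₀ N * ψ [] + (delay (pathSum≤ (ψ ∘ (u ∷_)) K 1) N + delay (pathSum≤ (ψ ∘ (h ∷_)) K 0) N)
    ≡⟨ move-middle (δ₀ N * ψ []) (delay (pathSum≤ (ψ ∘ (u ∷_)) K 1) N) (delay (pathSum≤ (ψ ∘ (h ∷_)) K 0) N) ⟩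
  delay (pathSum≤ (ψ ∘ (u ∷_)) K 1) N + δ₀ N * ψ [] + delay (pathSum≤ (ψ ∘ (h ∷_)) K 0) N ∎
  where
  U H : ℕ → Seq
  U k = pathSumOfLength (ψ ∘ (u ∷_)) k 1
  H k = pathSumOfLength (ψ ∘ (h ∷_)) k 0
  empty : ∀ N → pathSumOfLength ψ 0 0 N ≡ δ₀ N * ψ []
  empty zero    = +-identityʳ _
  empty (suc N) = +-identityʳ _
  move-middle : ∀ a b c → a + (b + c) ≡ b + a + c
  move-middle = solve-∀

pathSum≤-above : ∀ ψ K y N → pathSum≤ ψ (suc K) (suc y) N
  ≡ delay (pathSum≤ (ψ ∘ (u ∷_)) K (suc (suc y))) N + delay (pathSum≤ (ψ ∘ (h ∷_)) K (suc y)) N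
    + delay (pathSum≤ (ψ ∘ (d ∷_)) K y) N + pathSum≤ (ψ ∘ (v ∷_)) K y N
pathSum≤-above ψ K y N = begin
  pathSum≤ ψ (suc K) (suc y) N
    ≡⟨ ∑-upTo-suc (suc K) (λ k → pathSumOfLength ψ k (suc y) N) ⟩
  pathSumOfLength ψ 0 (suc y) N + ∑[ k ∈ upTo (suc K) ] pathSumOfLength ψ (suc k) (suc y) N
    ≡⟨ cong₂ _+_ empty (∑-cong ks (λ k → pathSumOfLength-above ψ k y N)) ⟩
  0ℤ + ∑[ k ∈ ks ] (delay (U k) N + delay (H k) N + delay (D k) N + V k N)
    ≡⟨ trans (+-identityˡ _)
             (∑-+₄ ks (λ k → delay (U k) N) (λ k → delay (H k) N) (λ k → delay (D k) N) (λ k → V k N)) ⟩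
  ∑[ k ∈ ks ] delay (U k) N + ∑[ k ∈ ks ] delay (H k) N + ∑[ k ∈ ks ] delay (D k) N + ∑[ k ∈ ks ] V k N
    ≡⟨ sym (cong-+₄ (delay-∑ ks U N) (delay-∑ ks H N) (delay-∑ ks D N) refl) ⟩
  delay (pathSum≤ (ψ ∘ (u ∷_)) K (suc (suc y))) N + delay (pathSum≤ (ψ ∘ (h ∷_)) K (suc y)) N
    + delay (pathSum≤ (ψ ∘ (d ∷_)) K y) N + pathSum≤ (ψ ∘ (v ∷_)) K y N ∎
  where
  ks = upTo (suc K)
  U H D V : ℕ → Seq
  U k = pathSumOfLength (ψ ∘ (u ∷_)) k (suc (suc y))
  H k = pathSumOfLength (ψ ∘ (h ∷_)) k (suc y)
  D k = pathSumOfLength (ψ ∘ (d ∷_)) k y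
  V k = pathSumOfLength (ψ ∘ (v ∷_)) k y
  empty : pathSumOfLength ψ 0 (suc y) N ≡ 0ℤ
  empty = trans (+-identityʳ (𝟙 ((0 ≡ᵇ N) ∧ false) * ψ [])) (cong (λ b → 𝟙 b * ψ []) (∧-zeroʳ (0 ≡ᵇ N)))

pathSum-ground : ∀ ψ N →
  pathSum ψ 0 N ≡ delay (pathSum (ψ ∘ (u ∷_)) 1) N + δ₀ N * ψ [] + delay (pathSum (ψ ∘ (h ∷_)) 0) N
pathSum-ground ψ zero = rearrange (1ℤ * ψ [])
  where
  rearrange : ∀ a → a + 0ℤ + 0ℤ ≡ 0ℤ + a + 0ℤ
  rearrange = solve-∀
pathSum-ground ψ (suc n) =
  trans (pathSum≤-ground ψ (n ℕ.+ suc n ℕ.+ 0) (suc n))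
        (cong-+₃ (stable (ψ ∘ (u ∷_)) 1 ℕₚ.≤-refl) refl (stable (ψ ∘ (h ∷_)) 0 z≤n))
  where
  stable : ∀ ψ′ y′ → y′ ≤ 1 → pathSum≤ ψ′ (n ℕ.+ suc n ℕ.+ 0) y′ n ≡ pathSum ψ′ y′ n
  stable ψ′ y′ y′≤1 = pathSum≤-stable ψ′ y′ n (s≤s⁻¹ (pathBound-step n y′≤1))

pathSum-above : ∀ ψ y N → pathSum ψ (suc y) N
  ≡ delay (pathSum (ψ ∘ (u ∷_)) (suc (suc y))) N + delay (pathSum (ψ ∘ (h ∷_)) (suc y)) N
    + delay (pathSum (ψ ∘ (d ∷_)) y) N + pathSum (ψ ∘ (v ∷_)) y N
pathSum-above ψ y zero = pathSum≤-above ψ y y 0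
pathSum-above ψ y (suc n) =
  trans (pathSum≤-above ψ K y (suc n))
        (cong-+₄ (stable (ψ ∘ (u ∷_)) (suc (suc y)) ℕₚ.≤-refl) (stable (ψ ∘ (h ∷_)) (suc y) (ℕₚ.n≤1+n _))
                 (stable (ψ ∘ (d ∷_)) y (ℕₚ.m≤n+m y 2))
                 (pathSum≤-stable (ψ ∘ (v ∷_)) y (suc n) (s≤s⁻¹ (pathBound-level (suc n) y))))
  where
  K = n ℕ.+ suc n ℕ.+ suc y
  stable : ∀ ψ′ y′ → y′ ≤ suc (suc y) → pathSum≤ ψ′ K y′ n ≡ pathSum ψ′ y′ n
  stable ψ′ y′ y′≤2+y = pathSum≤-stable ψ′ y′ n (s≤s⁻¹ (pathBound-step n y′≤2+y))

pathSum-linear : ∀ c ψ y N → pathSum (λ w → c + ψ w) y N ≡ pathSum ψ y N + c * pathSum (λ _ → 1ℤ) y N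
pathSum-linear c ψ y N =
  trans (∑-cong (upTo (suc (pathBound N y))) (λ k → pathSumOfLength-linear k))
        (∑-linear (upTo (suc (pathBound N y))) (λ k → pathSumOfLength ψ k y N)
                  (λ k → pathSumOfLength (λ _ → 1ℤ) k y N) c)
  where
  distribute : ∀ i c p → i * (c + p) ≡ i * p + c * (i * 1ℤ)
  distribute = solve-∀
  pathSumOfLength-linear : ∀ k → pathSumOfLength (λ w → c + ψ w) k y N
                                 ≡ pathSumOfLength ψ k y N + c * pathSumOfLength (λ _ → 1ℤ) k y N
  pathSumOfLength-linear k =
    trans (∑-cong (wordsOfLength k) (λ w → distribute (𝟙 (isPathFrom y N w)) c (ψ w)))
          (∑-linear (wordsOfLength k) (λ w → 𝟙 (isPathFrom y N w) * ψ w) (λ w → 𝟙 (isPathFrom y N w) * 1ℤ) c)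

pathCount : ℕ → Seq
pathCount = pathSum (λ _ → 1ℤ)

-- The clauses for d and v at level 0 follow countUAt; they never occur on a path.
uWeight : ℕ → List Step → ℤ
uWeight y       []      = 0ℤ
uWeight y       (u ∷ w) = weight y + uWeight (suc y) w
uWeight y       (h ∷ w) = uWeight y w
uWeight zero    (d ∷ w) = uWeight zero w
uWeight (suc y) (d ∷ w) = uWeight y w
uWeight zero    (v ∷ w) = uWeight zero w
uWeight (suc y) (v ∷ w) = uWeight y w

weightedPathSum : ℕ → Seq
weightedPathSum y = pathSum (uWeight y) y

pathCount-recurrence : LevelRecurrence pathCount (groundOnly δ₀)
pathCount-recurrence .ground N =
  trans (pathSum-ground _ N) (cong (λ z → delay (pathCount 1) N + z + delay (pathCount 0) N) (*-identityʳ (δ₀ N)))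
pathCount-recurrence .above y N =
  trans (pathSum-above _ y N)
        (cong (λ z → z + delay (pathCount (suc y)) N + delay (pathCount y) N + pathCount y N)
              (sym (+-identityʳ (delay (pathCount (suc (suc y))) N))))

delay-weightedPathSum-after-u : ∀ y N →
  delay (pathSum (λ w → weight y + uWeight (suc y) w) (suc y)) N
    ≡ delay (weightedPathSum (suc y)) N + weight y * delay (pathCount (suc y)) N
delay-weightedPathSum-after-u y N =
  trans (delay-cong (pathSum-linear (weight y) (uWeight (suc y)) (suc y)) N)
  (trans (delay-+ (weightedPathSum (suc y)) (λ m → weight y * pathCount (suc y) m) N)
         (cong (_+_ (delay (weightedPathSum (suc y)) N)) (delay-scale (weight y) (pathCount (suc y)) N)))

weightedPathSum-recurrence : LevelRecurrence weightedPathSum (λ y N → weight y * delay (pathCount (suc y)) N)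
weightedPathSum-recurrence .ground N =
  trans (pathSum-ground (uWeight 0) N)
  (trans (cong₂ (λ a z → a + z + delay (weightedPathSum 0) N)
                (delay-weightedPathSum-after-u 0 N) (*-zeroʳ (δ₀ N)))
         (cong (_+ delay (weightedPathSum 0) N)
               (+-identityʳ (delay (weightedPathSum 1) N + weight 0 * delay (pathCount 1) N))))
weightedPathSum-recurrence .above y N =
  trans (pathSum-above (uWeight (suc y)) y N)
        (cong (λ a → a + delay (weightedPathSum (suc y)) N + delay (weightedPathSum y) N + weightedPathSum y N)
              (delay-weightedPathSum-after-u (suc y) N))

∑-weight*countUAt : ∀ L y w → xlen w ℕ.+ y ≤ L →
                    ∑[ i ∈ upTo L ] (weight i * + countUAt (suc i) y w) ≡ uWeight y w
∑-weight*countUAt L y [] _ = trans (∑-cong (upTo L) (*-zeroʳ ∘ weight)) (∑-zero (upTo L))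
∑-weight*countUAt L y (u ∷ w) bound =
  trans (∑-cong (upTo L) (λ i → *-distribˡ-+ (weight i) (+ new-u i) (+ countUAt (suc i) (suc y) w)))
  (trans (∑-+ (upTo L) (λ i → weight i * + new-u i) (λ i → weight i * + countUAt (suc i) (suc y) w))
         (cong₂ _+_ (∑-indicator L y weight (ℕₚ.≤-trans (s≤s (ℕₚ.m≤n+m y (xlen w))) bound))
                    (∑-weight*countUAt L (suc y) w (ℕₚ.≤-trans (ℕₚ.≤-reflexive (ℕₚ.+-suc (xlen w) y)) bound))))
  where
  new-u : ℕ → ℕ
  new-u i = if y ≡ᵇ i then 1 else 0
∑-weight*countUAt L y       (h ∷ w) bound = ∑-weight*countUAt L y w (ℕₚ.≤-trans (ℕₚ.n≤1+n _) bound)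
∑-weight*countUAt L zero    (d ∷ w) bound = ∑-weight*countUAt L zero w (ℕₚ.≤-trans (ℕₚ.n≤1+n _) bound)
∑-weight*countUAt L (suc y) (d ∷ w) bound =
  ∑-weight*countUAt L y w (ℕₚ.≤-trans (ℕₚ.≤-trans (ℕₚ.+-monoʳ-≤ (xlen w) (ℕₚ.n≤1+n y)) (ℕₚ.n≤1+n _)) bound)
∑-weight*countUAt L zero    (v ∷ w) bound = ∑-weight*countUAt L zero w bound
∑-weight*countUAt L (suc y) (v ∷ w) bound =
  ∑-weight*countUAt L y w (ℕₚ.≤-trans (ℕₚ.+-monoʳ-≤ (xlen w) (ℕₚ.n≤1+n y)) bound)

altSum≡weightedPathSum : ∀ n → altSum n ≡ weightedPathSum 0 (suc n)
altSum≡weightedPathSum n = begin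
  altSum n
    ≡⟨ ∑-cong (upTo N) term ⟩
  ∑[ i ∈ upTo N ] ∑[ w ∈ paths ] uCount i w
    ≡⟨ ∑-comm (upTo N) paths uCount ⟩
  ∑[ w ∈ paths ] ∑[ i ∈ upTo N ] uCount i w
    ≡⟨ ∑-filter (isGMotzkin N) words (λ w → ∑[ i ∈ upTo N ] uCount i w) ⟩
  ∑[ w ∈ words ] (𝟙 (isGMotzkin N w) * ∑[ i ∈ upTo N ] uCount i w)
    ≡⟨ ∑-cong words (λ w → 𝟙-guard (isGMotzkin N w) (∑-weight*countUAt N 0 w ∘ length-bound w)) ⟩
  ∑[ w ∈ words ] (𝟙 (isPathFrom 0 N w) * uWeight 0 w)
    ≡⟨ trans (∑-concat (map wordsOfLength (upTo (suc (2 ℕ.* N)))) (λ w → 𝟙 (isPathFrom 0 N w) * uWeight 0 w))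
             (∑-map wordsOfLength (upTo (suc (2 ℕ.* N))) (λ ws → ∑[ w ∈ ws ] (𝟙 (isPathFrom 0 N w) * uWeight 0 w))) ⟩
  pathSum≤ (uWeight 0) (2 ℕ.* N) 0 N
    ≡⟨ pathSum≤-stable (uWeight 0) 0 N (ℕₚ.≤-reflexive (ℕₚ.+-assoc N N 0)) ⟩
  weightedPathSum 0 N ∎
  where
  N = suc n
  paths = gMotzkinPaths N
  words = wordsUpTo (2 ℕ.* N)
  uCount : ℕ → List Step → ℤ
  uCount i w = weight i * + countUAt (suc i) 0 w
  term : ∀ i → signℤ i * + (((i ℕ.+ 2) C 2) ℕ.* α n i) ≡ ∑[ w ∈ paths ] uCount i w
  term i = begin
    signℤ i * + (((i ℕ.+ 2) C 2) ℕ.* α n i)            ≡⟨ cong (signℤ i *_) (pos-* ((i ℕ.+ 2) C 2) (α n i)) ⟩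
    signℤ i * (+ ((i ℕ.+ 2) C 2) * + α n i)            ≡⟨ *-assoc (signℤ i) _ _ ⟨
    weight i * + α n i                                 ≡⟨ cong (weight i *_) (∑-pos paths (countUAt (suc i) 0)) ⟩
    weight i * ∑[ w ∈ paths ] (+ countUAt (suc i) 0 w) ≡⟨ ∑-*ˡ paths (weight i) (λ w → + countUAt (suc i) 0 w) ⟨
    ∑[ w ∈ paths ] uCount i w                          ∎
  length-bound : ∀ w → T (isGMotzkin N w) → xlen w ℕ.+ 0 ≤ N
  length-bound w isPath = ℕₚ.≤-reflexive
    (trans (ℕₚ.+-identityʳ (xlen w)) (ℕₚ.≡ᵇ⇒≡ (xlen w) N (proj₁ (Equivalence.to T-∧ isPath))))

theorem3p3 : (n : ℕ) → altSum n ≡ + (suc n ^ 2)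
theorem3p3 n = begin
  altSum n                  ≡⟨ altSum≡weightedPathSum n ⟩
  weightedPathSum 0 (suc n) ≡⟨ weighted₀≡square pathCount-recurrence weightedPathSum-recurrence (suc n) ⟩
  + suc n * + suc n         ≡⟨ pos-* (suc n) (suc n) ⟨
  + (suc n ℕ.* suc n)       ≡⟨ cong (λ k → + (suc n ℕ.* k)) (ℕₚ.*-identityʳ (suc n)) ⟨
  + (suc n ^ 2)             ∎
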